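{- Let $m\geq 2$ and $0\leq k\leq n$ be integers, and suppose it is not the case that simultaneously $k\not\equiv 1\pmod 3$, $m=3$ and $n\equiv 2\pmod 3$. Then $$\left\lfloor\tfrac{6k}{m}\right\rfloor+\left\lfloor\tfrac{6n-6k}{m}\right\rfloor+\left\lfloor\tfrac{2n}{m}\right\rfloor+\left\lfloor\tfrac{2n-2}{m}\right\rfloor\geq \left\lfloor\tfrac{3k}{m}\right\rfloor+\left\lfloor\tfrac{3n-3k}{m}\right\rfloor+\left\lfloor\tfrac{3n}{m}\right\rfloor+\left\lfloor\tfrac{2k}{m}\right\rfloor+\left\lfloor\tfrac{2n-2k}{m}\right\rfloor+\left\lfloor\tfrac{2n-1}{m}\right\rfloor.$$
   Context: $\lfloor x\rfloor$ denotes the greatest integer less than or equal to $x$. -}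

module Defs where

open import Data.Nat using (ℕ; NonZero)
open import Data.Integer using (ℤ)
open import Data.Integer.DivMod using (_/ℕ_)

-- ⌊ a / m ⌋ : floor of the integer a divided by the positive natural m.
-- (_/ℕ_ is Euclidean division; for positive divisor it is the floor,
--  since the remainder a %ℕ m lies in [0, m).)
⌊_/_⌋ : ℤ → (m : ℕ) → .{{NonZero m}} → ℤ
⌊ a / m ⌋ = a /ℕ m

module Submission where

-- Write F(a) = ⌊a/m⌋, x = k, y = n − k.  The inequality rearranges to
--   [F(3x)+F(3y)+F(3x+3y)] + [F(2x)+F(2y)] + F(2n−1)
--     ≤ [F(6x)+F(6y)] + F(2x+2y) + F(2n−2),
-- which is the sum of three elementary facts about F:
--   (1) Landau: F(a)+F(b)+F(a+b) ≤ F(2a)+F(2b)       (applied to a = 3x, b = 3y),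
--   (2) superadditivity: F(a)+F(b) ≤ F(a+b)           (applied to 2x, 2y),
--   (3) F(t+1) ≤ F(t)+1, with equality only when m ∣ t+1   (t = 2n−2).
-- The only difficulty is when (3) is an equality, i.e. 2x+2y ≡ 1 (mod m):
-- then (1) or (2) must be strict.  If (2) is an equality too, the residues of
-- x and y modulo m are 0 and (m+1)/2 in some order, and then (1) is strict
-- with gap exactly 1 unless m = 3 — the excluded case of the statement.

open import Data.Nat using (ℕ; NonZero) renaming (_≤_ to _≤ℕ_)

module Quotients (m : ℕ) .{{_ : NonZero m}} where
  open import Data.Nat
  open import Data.Nat.Properties
  open import Data.Nat.DivMod
  open import Data.Nat.Divisibility using (divides)
  open import Data.Product using (_×_; _,_)
  open import Data.Sum using (_⊎_; inj₁; inj₂)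
  open import Relation.Nullary using (¬_; yes; no; contradiction)
  open import Relation.Binary.PropositionalEquality
  open import Data.Nat.Tactic.RingSolver using (solve-∀)

  ⌊_⌋ₘ : ℕ → ℕ
  ⌊ a ⌋ₘ = a / m

  ⌊⌋-shift : ∀ {e} a q → e ≡ a + q * m → ⌊ e ⌋ₘ ≡ ⌊ a ⌋ₘ + q
  ⌊⌋-shift a q refl =
    trans (+-distrib-/-∣ʳ a (divides q refl)) (cong (⌊ a ⌋ₘ +_) (m*n/n≡m q m))

  sum-shift : ∀ a b p q → (a + p * m) + (b + q * m) ≡ (a + b) + (p + q) * m
  sum-shift a b p q = regroup a b p q m
    where
    regroup : ∀ a b p q n → (a + p * n) + (b + q * n) ≡ (a + b) + (p + q) * n
    regroup = solve-∀

  scale-shift : ∀ c a p → c * (a + p * m) ≡ c * a + (c * p) * m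
  scale-shift c a p = distribute c a p m
    where
    distribute : ∀ c a p n → c * (a + p * n) ≡ c * a + (c * p) * n
    distribute = solve-∀

  scaled-residue : ∀ c a → c * a ≡ c * (a % m) + (c * ⌊ a ⌋ₘ) * m
  scaled-residue c a = trans (cong (c *_) (m≡m%n+[m/n]*n a m)) (scale-shift c (a % m) ⌊ a ⌋ₘ)

  reaches : ∀ {a} → 1 ≤ ⌊ a ⌋ₘ → m ≤ a
  reaches 1≤⌊a⌋ = m/n≢0⇒n≤m (n>0⇒n≢0 1≤⌊a⌋)

  -- (2) Superadditivity: the quotients of the residues can only add a carry.
  ⌊⌋-superadditive : ∀ a b → ⌊ a ⌋ₘ + ⌊ b ⌋ₘ ≤ ⌊ a + b ⌋ₘ
  ⌊⌋-superadditive a b = begin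
    ⌊ a ⌋ₘ + ⌊ b ⌋ₘ                              ≤⟨ m≤n+m (⌊ a ⌋ₘ + ⌊ b ⌋ₘ) ⌊ a % m + b % m ⌋ₘ ⟩
    ⌊ a % m + b % m ⌋ₘ + (⌊ a ⌋ₘ + ⌊ b ⌋ₘ)       ≡⟨ ⌊⌋-shift _ _ split ⟨
    ⌊ a + b ⌋ₘ                                   ∎
    where
    open ≤-Reasoning
    split : a + b ≡ (a % m + b % m) + (⌊ a ⌋ₘ + ⌊ b ⌋ₘ) * m
    split = trans (cong₂ _+_ (m≡m%n+[m/n]*n a m) (m≡m%n+[m/n]*n b m))
                  (sum-shift (a % m) (b % m) ⌊ a ⌋ₘ ⌊ b ⌋ₘ)

  ⌊⌋-step : ∀ t → ⌊ suc t ⌋ₘ ≡ ⌊ t ⌋ₘ ⊎ suc t ≡ suc ⌊ t ⌋ₘ * m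
  ⌊⌋-step t with suc (t % m) ≟ m
  ... | yes carry = inj₂ (trans (cong suc (m≡m%n+[m/n]*n t m)) (cong (_+ ⌊ t ⌋ₘ * m) carry))
  ... | no ¬carry = inj₁ (trans (⌊⌋-shift (suc (t % m)) ⌊ t ⌋ₘ (cong suc (m≡m%n+[m/n]*n t m)))
                                (cong (_+ ⌊ t ⌋ₘ) (m<n⇒m/n≡0 (≤∧≢⇒< (m%n<n t m) ¬carry))))

  Gap : ℕ → ℕ → ℕ → Set
  Gap δ a b = δ + (⌊ a ⌋ₘ + ⌊ b ⌋ₘ + ⌊ a + b ⌋ₘ) ≤ ⌊ 2 * a ⌋ₘ + ⌊ 2 * b ⌋ₘ

  gap-shift : ∀ {δ} a b p q → Gap δ a b → Gap δ (a + p * m) (b + q * m)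
  gap-shift {δ} a b p q gap = begin
    δ + (⌊ a + p * m ⌋ₘ + ⌊ b + q * m ⌋ₘ + ⌊ (a + p * m) + (b + q * m) ⌋ₘ)
      ≡⟨ cong (δ +_) (cong₂ _+_ (cong₂ _+_ (⌊⌋-shift a p refl) (⌊⌋-shift b q refl))
                                (⌊⌋-shift (a + b) (p + q) (sum-shift a b p q))) ⟩
    δ + ((⌊ a ⌋ₘ + p) + (⌊ b ⌋ₘ + q) + (⌊ a + b ⌋ₘ + (p + q)))
      ≡⟨ collect δ ⌊ a ⌋ₘ ⌊ b ⌋ₘ ⌊ a + b ⌋ₘ p q ⟩
    δ + (⌊ a ⌋ₘ + ⌊ b ⌋ₘ + ⌊ a + b ⌋ₘ) + (2 * p + 2 * q)
      ≤⟨ +-monoˡ-≤ (2 * p + 2 * q) gap ⟩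
    ⌊ 2 * a ⌋ₘ + ⌊ 2 * b ⌋ₘ + (2 * p + 2 * q)
      ≡⟨ distribute ⌊ 2 * a ⌋ₘ ⌊ 2 * b ⌋ₘ p q ⟩
    (⌊ 2 * a ⌋ₘ + 2 * p) + (⌊ 2 * b ⌋ₘ + 2 * q)
      ≡⟨ cong₂ _+_ (⌊⌋-shift (2 * a) (2 * p) (scale-shift 2 a p))
                   (⌊⌋-shift (2 * b) (2 * q) (scale-shift 2 b q)) ⟨
    ⌊ 2 * (a + p * m) ⌋ₘ + ⌊ 2 * (b + q * m) ⌋ₘ ∎
    where
    open ≤-Reasoning
    collect : ∀ d x y z p q →
      d + ((x + p) + (y + q) + (z + (p + q))) ≡ d + (x + y + z) + (2 * p + 2 * q)
    collect = solve-∀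
    distribute : ∀ x y p q → x + y + (2 * p + 2 * q) ≡ (x + 2 * p) + (y + 2 * q)
    distribute = solve-∀

  gap-sym : ∀ {δ} a b → Gap δ a b → Gap δ b a
  gap-sym {δ} a b = subst₂ _≤_ (cong (δ +_) swap) (+-comm ⌊ 2 * a ⌋ₘ ⌊ 2 * b ⌋ₘ)
    where
    swap : ⌊ a ⌋ₘ + ⌊ b ⌋ₘ + ⌊ a + b ⌋ₘ ≡ ⌊ b ⌋ₘ + ⌊ a ⌋ₘ + ⌊ b + a ⌋ₘ
    swap = cong₂ _+_ (+-comm ⌊ a ⌋ₘ ⌊ b ⌋ₘ) (cong ⌊_⌋ₘ (+-comm a b))

  -- (1) Landau's inequality.  For residues r, s < m it says F(r+s) ≤ F(2r)+F(2s),
  -- which holds since r + s ≤ 2 max(r, s).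
  landau : ∀ a b → Gap 0 a b
  landau a b = subst₂ (Gap 0) (sym (m≡m%n+[m/n]*n a m)) (sym (m≡m%n+[m/n]*n b m))
    (gap-shift {0} (a % m) (b % m) ⌊ a ⌋ₘ ⌊ b ⌋ₘ (on-residues (m%n<n a m) (m%n<n b m)))
    where
    twice : ∀ s → s + s ≡ 2 * s
    twice = solve-∀
    on-residues : ∀ {r s} → r < m → s < m → Gap 0 r s
    on-residues {r} {s} r<m s<m rewrite m<n⇒m/n≡0 r<m | m<n⇒m/n≡0 s<m with ≤-total r s
    ... | inj₁ r≤s = ≤-trans (/-monoˡ-≤ m (subst (r + s ≤_) (twice s) (+-monoˡ-≤ s r≤s))) (m≤n+m _ _)
    ... | inj₂ s≤r = ≤-trans (/-monoˡ-≤ m (subst (r + s ≤_) (twice r) (+-monoʳ-≤ r s≤r))) (m≤m+n _ _)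

  Tight : ℕ → ℕ → Set
  Tight a b = (a + b) % m ≡ 1 × ⌊ a + b ⌋ₘ ≤ ⌊ a ⌋ₘ + ⌊ b ⌋ₘ

  tight-unshift : ∀ a b p q → Tight (a + p * m) (b + q * m) → Tight a b
  tight-unshift a b p q (≡1 , sharp) = residue , +-cancelʳ-≤ (p + q) _ _ quotient
    where
    open ≤-Reasoning
    residue : (a + b) % m ≡ 1
    residue = trans (sym ([m+kn]%n≡m%n (a + b) (p + q) m))
                    (trans (cong (_% m) (sym (sum-shift a b p q))) ≡1)
    regroup : ∀ x y p q → (x + p) + (y + q) ≡ (x + y) + (p + q)
    regroup = solve-∀
    quotient : ⌊ a + b ⌋ₘ + (p + q) ≤ ⌊ a ⌋ₘ + ⌊ b ⌋ₘ + (p + q)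
    quotient = begin
      ⌊ a + b ⌋ₘ + (p + q)                         ≡⟨ ⌊⌋-shift (a + b) (p + q) (sum-shift a b p q) ⟨
      ⌊ (a + p * m) + (b + q * m) ⌋ₘ               ≤⟨ sharp ⟩
      ⌊ a + p * m ⌋ₘ + ⌊ b + q * m ⌋ₘ
        ≡⟨ cong₂ _+_ (⌊⌋-shift a p refl) (⌊⌋-shift b q refl) ⟩
      (⌊ a ⌋ₘ + p) + (⌊ b ⌋ₘ + q)                  ≡⟨ regroup ⌊ a ⌋ₘ ⌊ b ⌋ₘ p q ⟩
      ⌊ a ⌋ₘ + ⌊ b ⌋ₘ + (p + q)                    ∎

  Exceptional : ℕ → ℕ → Set
  Exceptional k n = (k % 3 ≢ 1) × (m ≡ 3) × (n % 3 ≡ 2)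

  exceptional : ∀ {x y} → m ≡ 3 → x % m ≢ 1 → x % m + y % m ≡ 2 → Exceptional x (x + y)
  exceptional {x} {y} m≡3 x≢1 sum≡2 = x%3≢1 , m≡3 , sum%3≡2
    where
    open ≡-Reasoning
    x%3≢1 : x % 3 ≢ 1
    x%3≢1 x%3≡1 = x≢1 (trans (%-congʳ m≡3) x%3≡1)
    sum%3≡2 : (x + y) % 3 ≡ 2
    sum%3≡2 = begin
      (x + y) % 3            ≡⟨ %-distribˡ-+ x y 3 ⟩
      (x % 3 + y % 3) % 3    ≡⟨ cong (_% 3) (cong₂ _+_ (%-congʳ m≡3) (%-congʳ m≡3)) ⟨
      (x % m + y % m) % 3    ≡⟨ cong (_% 3) sum≡2 ⟩
      2                      ∎

  double≤1⇒0 : ∀ a → 2 * a ≤ 1 → a ≡ 0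
  double≤1⇒0 zero    _    = refl
  double≤1⇒0 (suc a) 2a≤1 = contradiction 2a≤1 (<⇒≱ (*-monoʳ-≤ 2 (s≤s z≤n)))

  -- The remaining facts need m ≥ 2, so that 1 is its own residue.
  module _ (2≤m : 2 ≤ m) where

    double-residue : ∀ {r} → r < m → ⌊ 2 * r ⌋ₘ ≤ 1
    double-residue r<m = ≤-pred (m<n*o⇒m/o<n (*-monoʳ-< 2 r<m))

    lower-vanishes : ∀ {a b} → 2 * a + 2 * b ≡ suc m → m ≤ 2 * b → a ≡ 0
    lower-vanishes {a} e m≤2b =
      double≤1⇒0 a (+-cancelʳ-≤ m (2 * a) 1 (≤-trans (+-monoʳ-≤ (2 * a) m≤2b) (≤-reflexive e)))

    straddle : ∀ {r s} → 1 ≤ ⌊ 2 * r ⌋ₘ + ⌊ 2 * s ⌋ₘ → 2 * r + 2 * s ≡ suc m →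
      (r ≡ 0 × 2 * s ≡ suc m) ⊎ (s ≡ 0 × 2 * r ≡ suc m)
    straddle {r} {s} carry e with 2 * r <? m
    ... | yes 2r<m = inj₁ (r≡0 , subst (λ z → 2 * z + 2 * s ≡ suc m) r≡0 e)
      where
      r≡0 : r ≡ 0
      r≡0 = lower-vanishes {r} {s} e
              (reaches {2 * s} (subst (λ z → 1 ≤ z + ⌊ 2 * s ⌋ₘ) (m<n⇒m/n≡0 2r<m) carry))
    ... | no 2r≮m = inj₂ (s≡0 , trans (sym (+-identityʳ (2 * r)))
                                      (subst (λ z → 2 * r + 2 * z ≡ suc m) s≡0 e))
      where
      s≡0 : s ≡ 0
      s≡0 = lower-vanishes {s} {r} (trans (+-comm (2 * s) (2 * r)) e) (≮⇒≥ 2r≮m)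

    -- Tight doubles of residues: 2r + 2s = 1 + u m with u ≤ F(2r)+F(2s) ≤ 2;
    -- parity rules out u = 0, 2, so u = 1 and {r, s} = {0, (m+1)/2}.
    tight-residues : ∀ {r s} → r < m → s < m → Tight (2 * r) (2 * s) →
      (r ≡ 0 × 2 * s ≡ suc m) ⊎ (s ≡ 0 × 2 * r ≡ suc m)
    tight-residues {r} {s} r<m s<m (≡1 , sharp) = by-quotient ⌊ 2 * r + 2 * s ⌋ₘ sharp expansion
      where
      expansion : 2 * r + 2 * s ≡ 1 + ⌊ 2 * r + 2 * s ⌋ₘ * m
      expansion = trans (m≡m%n+[m/n]*n _ m) (cong (_+ ⌊ 2 * r + 2 * s ⌋ₘ * m) ≡1)
      bounded : ⌊ 2 * r ⌋ₘ + ⌊ 2 * s ⌋ₘ ≤ 2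
      bounded = +-mono-≤ (double-residue r<m) (double-residue s<m)
      by-quotient : ∀ u → u ≤ ⌊ 2 * r ⌋ₘ + ⌊ 2 * s ⌋ₘ → 2 * r + 2 * s ≡ 1 + u * m →
        (r ≡ 0 × 2 * s ≡ suc m) ⊎ (s ≡ 0 × 2 * r ≡ suc m)
      by-quotient 0 _ e = contradiction (trans (*-distribˡ-+ 2 r s) e) (even≢odd (r + s) 0)
      by-quotient 1 carry e = straddle carry (trans e (cong suc (+-identityʳ m)))
      by-quotient 2 _ e = contradiction (trans (*-distribˡ-+ 2 r s) e) (even≢odd (r + s) m)
      by-quotient (suc (suc (suc u))) u≤ _ =
        contradiction (≤-trans u≤ bounded) λ { (s≤s (s≤s ())) }

    -- If 2w = m + 1 and m ≠ 3 (so m > 3 by parity), then F(3w) = 1 and F(6w) = 3: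
    -- the gap at (3w, 0) is 1.
    gap-half : ∀ {w} → 2 * w ≡ suc m → m ≢ 3 → Gap 1 (3 * w) 0
    gap-half {w} e m≢3 = ≤-reflexive (begin
      1 + (⌊ 3 * w ⌋ₘ + ⌊ 0 ⌋ₘ + ⌊ 3 * w + 0 ⌋ₘ)
        ≡⟨ cong (λ z → 1 + (⌊ 3 * w ⌋ₘ + ⌊ 0 ⌋ₘ + ⌊ z ⌋ₘ)) (+-identityʳ (3 * w)) ⟩
      1 + (⌊ 3 * w ⌋ₘ + ⌊ 0 ⌋ₘ + ⌊ 3 * w ⌋ₘ)
        ≡⟨ cong₂ (λ f z → 1 + (f + z + f)) thrice (0/n≡0 m) ⟩
      3
        ≡⟨ cong₂ _+_ sixfold (0/n≡0 m) ⟨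
      ⌊ 2 * (3 * w) ⌋ₘ + ⌊ 2 * 0 ⌋ₘ ∎)
      where
      open ≡-Reasoning
      4≤m : 4 ≤ m
      4≤m = ≤∧≢⇒< (≤∧≢⇒< 2≤m (λ 2≡m → even≢odd w 1 (trans e (cong suc (sym 2≡m)))))
                  (λ 3≡m → m≢3 (sym 3≡m))
      3w≡ : 3 * w ≡ suc w + 1 * m
      3w≡ = trans (split₁ w) (trans (cong (w +_) e) (split₂ w m))
        where
        split₁ : ∀ w → 3 * w ≡ w + 2 * w
        split₁ = solve-∀
        split₂ : ∀ w m → w + suc m ≡ suc w + 1 * m
        split₂ = solve-∀
      6w≡ : 2 * (3 * w) ≡ 3 + 3 * m
      6w≡ = trans (swap w) (trans (cong (3 *_) e) (*-suc 3 m))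
        where
        swap : ∀ w → 2 * (3 * w) ≡ 3 * (2 * w)
        swap = solve-∀
      w+1<m : suc w < m
      w+1<m = *-cancelˡ-< 2 (suc w) m (subst₂ _<_ (sym 2w+2≡) (twice m) (+-monoˡ-< m 4≤m))
        where
        2w+2≡ : 2 * suc w ≡ 3 + m
        2w+2≡ = trans (*-suc 2 w) (cong (2 +_) e)
        twice : ∀ m → m + m ≡ 2 * m
        twice = solve-∀
      thrice : ⌊ 3 * w ⌋ₘ ≡ 1
      thrice = trans (⌊⌋-shift (suc w) 1 3w≡) (cong (_+ 1) (m<n⇒m/n≡0 w+1<m))
      sixfold : ⌊ 2 * (3 * w) ⌋ₘ ≡ 3
      sixfold = trans (⌊⌋-shift 3 3 6w≡) (cong (_+ 3) (m<n⇒m/n≡0 4≤m))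

    -- Strict Landau gap: if the doubles 2x, 2y are tight and (x, x+y) is not
    -- exceptional, then the gap at (3x, 3y) is at least 1.  By shift invariance
    -- it suffices to treat the residues r, s of x, y, which tight-residues pins down.
    strict-gap : ∀ x y → Tight (2 * x) (2 * y) → ¬ Exceptional x (x + y) → Gap 1 (3 * x) (3 * y)
    strict-gap x y tight ¬exceptional =
      subst₂ (Gap 1) (sym (scaled-residue 3 x)) (sym (scaled-residue 3 y))
        (gap-shift {1} (3 * r) (3 * s) (3 * ⌊ x ⌋ₘ) (3 * ⌊ y ⌋ₘ) residue-gap)
      where
      r s : ℕ
      r = x % m
      s = y % m
      half : ∀ {z} → 2 * z ≡ suc m → m ≡ 3 → z ≡ 2
      half {z} 2z≡ m≡3 = *-cancelˡ-≡ z 2 2 (trans 2z≡ (cong suc m≡3))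
      residue-gap : Gap 1 (3 * r) (3 * s)
      residue-gap with tight-residues (m%n<n x m) (m%n<n y m)
                         (tight-unshift (2 * r) (2 * s) (2 * ⌊ x ⌋ₘ) (2 * ⌊ y ⌋ₘ)
                           (subst₂ Tight (scaled-residue 2 x) (scaled-residue 2 y) tight))
      ... | inj₁ (r≡0 , 2s≡) = subst (λ z → Gap 1 (3 * z) (3 * s)) (sym r≡0)
                                 (gap-sym {1} (3 * s) 0 (gap-half {s} 2s≡ m≢3))
        where
        m≢3 : m ≢ 3
        m≢3 m≡3 = ¬exceptional (exceptional m≡3 (λ r≡1 → 0≢1+n (trans (sym r≡0) r≡1))
                                  (cong₂ _+_ r≡0 (half 2s≡ m≡3)))
      ... | inj₂ (s≡0 , 2r≡) = subst (λ z → Gap 1 (3 * r) (3 * z)) (sym s≡0)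
                                 (gap-half {r} 2r≡ m≢3)
        where
        m≢3 : m ≢ 3
        m≢3 m≡3 = ¬exceptional (exceptional m≡3
                                  (λ r≡1 → 0≢1+n (suc-injective (trans (sym r≡1) (half 2r≡ m≡3))))
                                  (cong₂ _+_ (half 2r≡ m≡3) s≡0))

    -- The natural-number form of the theorem, with t = 2n − 2 (so 2x + 2y = t + 2):
    -- the Landau sum, the superadditivity defect and F(t) − F(t+1) add up to ≥ 0.
    floor-budget : ∀ x y t → 2 * x + 2 * y ≡ suc (suc t) → ¬ Exceptional x (x + y) →
      (⌊ 3 * x ⌋ₘ + ⌊ 3 * y ⌋ₘ + ⌊ 3 * x + 3 * y ⌋ₘ) + (⌊ 2 * x ⌋ₘ + ⌊ 2 * y ⌋ₘ) + ⌊ suc t ⌋ₘ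
        ≤ (⌊ 2 * (3 * x) ⌋ₘ + ⌊ 2 * (3 * y) ⌋ₘ) + ⌊ 2 * x + 2 * y ⌋ₘ + ⌊ t ⌋ₘ
    floor-budget x y t 2x+2y≡ ¬exceptional with ⌊⌋-step t
    ... | inj₁ flat = +-mono-≤ (+-mono-≤ (landau (3 * x) (3 * y)) (⌊⌋-superadditive (2 * x) (2 * y)))
                               (≤-reflexive flat)
    ... | inj₂ t+1≡ = begin
      P + Q + ⌊ suc t ⌋ₘ      ≡⟨ cong (P + Q +_) jump ⟩
      P + Q + suc ⌊ t ⌋ₘ      ≡⟨ +-suc (P + Q) ⌊ t ⌋ₘ ⟩
      suc (P + Q) + ⌊ t ⌋ₘ    ≤⟨ +-monoˡ-≤ ⌊ t ⌋ₘ slack ⟩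
      P′ + Q′ + ⌊ t ⌋ₘ        ∎
      where
      open ≤-Reasoning
      P Q P′ Q′ : ℕ
      P = ⌊ 3 * x ⌋ₘ + ⌊ 3 * y ⌋ₘ + ⌊ 3 * x + 3 * y ⌋ₘ
      Q = ⌊ 2 * x ⌋ₘ + ⌊ 2 * y ⌋ₘ
      P′ = ⌊ 2 * (3 * x) ⌋ₘ + ⌊ 2 * (3 * y) ⌋ₘ
      Q′ = ⌊ 2 * x + 2 * y ⌋ₘ
      jump : ⌊ suc t ⌋ₘ ≡ suc ⌊ t ⌋ₘ
      jump = trans (cong ⌊_⌋ₘ t+1≡) (m*n/n≡m (suc ⌊ t ⌋ₘ) m)
      odd : (2 * x + 2 * y) % m ≡ 1
      odd = trans (cong (_% m) (trans 2x+2y≡ (cong suc t+1≡)))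
                  (trans ([m+kn]%n≡m%n 1 (suc ⌊ t ⌋ₘ) m) (m<n⇒m%n≡m 2≤m))
      -- Either superadditivity is strict at (2x, 2y), or (2x, 2y) is tight
      -- and the Landau gap at (3x, 3y) is strict.
      slack : suc (P + Q) ≤ P′ + Q′
      slack with Q <? Q′
      ... | yes Q<Q′ = subst (_≤ P′ + Q′) (+-suc P Q) (+-mono-≤ (landau (3 * x) (3 * y)) Q<Q′)
      ... | no Q≮Q′ = +-mono-≤ (strict-gap x y (odd , ≮⇒≥ Q≮Q′) ¬exceptional)
                               (⌊⌋-superadditive (2 * x) (2 * y))

    floor-inequality : ∀ x y n → x + y ≡ suc n → ¬ Exceptional x (suc n) →
      ⌊ 3 * x ⌋ₘ + ⌊ 3 * y ⌋ₘ + ⌊ 3 * suc n ⌋ₘ + ⌊ 2 * x ⌋ₘ + ⌊ 2 * y ⌋ₘ + ⌊ suc (2 * n) ⌋ₘ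
        ≤ ⌊ 6 * x ⌋ₘ + ⌊ 6 * y ⌋ₘ + ⌊ 2 * suc n ⌋ₘ + ⌊ 2 * n ⌋ₘ
    floor-inequality x y n x+y≡ ¬exceptional = begin
      P + ⌊ 3 * suc n ⌋ₘ + ⌊ 2 * x ⌋ₘ + ⌊ 2 * y ⌋ₘ + ⌊ suc (2 * n) ⌋ₘ
        ≡⟨ cong (λ z → P + ⌊ z ⌋ₘ + ⌊ 2 * x ⌋ₘ + ⌊ 2 * y ⌋ₘ + ⌊ suc (2 * n) ⌋ₘ) (scaled-sum 3) ⟨
      P + ⌊ 3 * x + 3 * y ⌋ₘ + ⌊ 2 * x ⌋ₘ + ⌊ 2 * y ⌋ₘ + ⌊ suc (2 * n) ⌋ₘ
        ≡⟨ cong (_+ ⌊ suc (2 * n) ⌋ₘ) (+-assoc (P + ⌊ 3 * x + 3 * y ⌋ₘ) ⌊ 2 * x ⌋ₘ ⌊ 2 * y ⌋ₘ) ⟩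
      (P + ⌊ 3 * x + 3 * y ⌋ₘ) + (⌊ 2 * x ⌋ₘ + ⌊ 2 * y ⌋ₘ) + ⌊ suc (2 * n) ⌋ₘ
        ≤⟨ floor-budget x y (2 * n) (trans (scaled-sum 2) (*-suc 2 n))
             (subst (λ z → ¬ Exceptional x z) (sym x+y≡) ¬exceptional) ⟩
      ⌊ 2 * (3 * x) ⌋ₘ + ⌊ 2 * (3 * y) ⌋ₘ + ⌊ 2 * x + 2 * y ⌋ₘ + ⌊ 2 * n ⌋ₘ
        ≡⟨ cong₂ (λ a b → ⌊ a ⌋ₘ + ⌊ b ⌋ₘ + ⌊ 2 * x + 2 * y ⌋ₘ + ⌊ 2 * n ⌋ₘ)
                 (*-assoc 2 3 x) (*-assoc 2 3 y) ⟨
      ⌊ 6 * x ⌋ₘ + ⌊ 6 * y ⌋ₘ + ⌊ 2 * x + 2 * y ⌋ₘ + ⌊ 2 * n ⌋ₘ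
        ≡⟨ cong (λ z → ⌊ 6 * x ⌋ₘ + ⌊ 6 * y ⌋ₘ + ⌊ z ⌋ₘ + ⌊ 2 * n ⌋ₘ) (scaled-sum 2) ⟩
      ⌊ 6 * x ⌋ₘ + ⌊ 6 * y ⌋ₘ + ⌊ 2 * suc n ⌋ₘ + ⌊ 2 * n ⌋ₘ ∎
      where
      open ≤-Reasoning
      P : ℕ
      P = ⌊ 3 * x ⌋ₘ + ⌊ 3 * y ⌋ₘ
      scaled-sum : ∀ c → c * x + c * y ≡ c * suc n
      scaled-sum c = trans (sym (*-distribˡ-+ c x y)) (cong (c *_) x+y≡)

open import Defs
open import Data.Nat.DivMod using (_%_)
open import Data.Integer using (ℤ; +_; _-_; _+_; _*_; _≥_)
open import Data.Product using (_×_)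
open import Relation.Binary.PropositionalEquality using (_≡_; _≢_)
open import Relation.Nullary using (¬_)

import Data.Nat as ℕ
open import Data.Nat using (zero; suc; _∸_; z≤n; s≤s)
open import Data.Nat.Properties using (m+[n∸m]≡n)
open import Data.Integer using (_≤_; +≤+)
open import Data.Integer.Properties using (pos-+; pos-*; ≤-refl)
open import Relation.Binary.PropositionalEquality
  using (refl; sym; trans; cong; cong₂; subst₂; module ≡-Reasoning)
open import Data.Integer.Tactic.RingSolver using (solve-∀)

×-embed : ∀ c a → + c * + a ≡ + (c ℕ.* a)
×-embed c a = sym (pos-* c a)

scaled-difference : ∀ c k y {n} → k ℕ.+ y ≡ n → + c * + n - + c * + k ≡ + (c ℕ.* y)
scaled-difference c k y refl = begin
  + c * + (k ℕ.+ y) - + c * + k     ≡⟨ cong (λ z → + c * z - + c * + k) (pos-+ k y) ⟩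
  + c * (+ k + + y) - + c * + k     ≡⟨ cancel (+ c) (+ k) (+ y) ⟩
  + c * + y                         ≡⟨ ×-embed c y ⟩
  + (c ℕ.* y)                       ∎
  where
  open ≡-Reasoning
  cancel : ∀ c k y → c * (k + y) - c * k ≡ c * y
  cancel = solve-∀

double-minus-two : ∀ n → + 2 * + suc n - + 2 ≡ + (2 ℕ.* n)
double-minus-two n = trans (cong (λ z → + 2 * z - + 2) (pos-+ 1 n)) (trans (expand (+ n)) (×-embed 2 n))
  where
  expand : ∀ z → + 2 * (+ 1 + z) - + 2 ≡ + 2 * z
  expand = solve-∀

double-minus-one : ∀ n → + 2 * + suc n - + 1 ≡ + suc (2 ℕ.* n)
double-minus-one n = trans (cong (λ z → + 2 * z - + 1) (pos-+ 1 n))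
                           (trans (expand (+ n)) (cong (_+_ (+ 1)) (×-embed 2 n)))
  where
  expand : ∀ z → + 2 * (+ 1 + z) - + 1 ≡ + 1 + + 2 * z
  expand = solve-∀

⌊⌋-embed : ∀ {e} a {m} .{{_ : NonZero m}} → e ≡ + a → ⌊ e / m ⌋ ≡ + (a ℕ./ m)
⌊⌋-embed a refl = refl

-- For n = 0 both sides evaluate to ⌊−2/m⌋ = ⌊−1/m⌋ = −1, which Agda computes once m
-- is split into 2 and 3 + m′.  For n ≥ 1 every floor has a natural-number argument,
-- and the theorem is Quotients.floor-inequality with x = k, y = n − k.
lemma3 : (m k n : ℕ) → .{{_ : NonZero m}} → 2 ≤ℕ m → k ≤ℕ n →
    ¬ ((k % 3 ≢ 1) × (m ≡ 3) × (n % 3 ≡ 2)) →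
    ⌊ + 6 * + k / m ⌋ + ⌊ + 6 * + n - + 6 * + k / m ⌋ + ⌊ + 2 * + n / m ⌋ + ⌊ + 2 * + n - + 2 / m ⌋
      ≥ ⌊ + 3 * + k / m ⌋ + ⌊ + 3 * + n - + 3 * + k / m ⌋ + ⌊ + 3 * + n / m ⌋
        + ⌊ + 2 * + k / m ⌋ + ⌊ + 2 * + n - + 2 * + k / m ⌋ + ⌊ + 2 * + n - + 1 / m ⌋
lemma3 (suc zero) _ zero (s≤s ()) _ _
lemma3 (suc (suc zero)) zero zero _ z≤n _ = ≤-refl
lemma3 (suc (suc (suc _))) zero zero _ z≤n _ = ≤-refl
lemma3 m k (suc n) 2≤m k≤n ¬exceptional =
  subst₂ _≤_ (sym smaller) (sym larger) (+≤+ (floor-inequality 2≤m k y n k+y≡ ¬exceptional))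
  where
  open Quotients m using (⌊_⌋ₘ; floor-inequality)
  y : ℕ
  y = suc n ∸ k
  k+y≡ : k ℕ.+ y ≡ suc n
  k+y≡ = m+[n∸m]≡n k≤n
  larger : ⌊ + 6 * + k / m ⌋ + ⌊ + 6 * + suc n - + 6 * + k / m ⌋ + ⌊ + 2 * + suc n / m ⌋
             + ⌊ + 2 * + suc n - + 2 / m ⌋
           ≡ + ⌊ 6 ℕ.* k ⌋ₘ + + ⌊ 6 ℕ.* y ⌋ₘ + + ⌊ 2 ℕ.* suc n ⌋ₘ + + ⌊ 2 ℕ.* n ⌋ₘ
  larger = cong₂ _+_ (cong₂ _+_ (cong₂ _+_ (⌊⌋-embed _ (×-embed 6 k))
                                           (⌊⌋-embed _ (scaled-difference 6 k y k+y≡)))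
                                (⌊⌋-embed _ (×-embed 2 (suc n))))
                     (⌊⌋-embed _ (double-minus-two n))
  smaller : ⌊ + 3 * + k / m ⌋ + ⌊ + 3 * + suc n - + 3 * + k / m ⌋ + ⌊ + 3 * + suc n / m ⌋
              + ⌊ + 2 * + k / m ⌋ + ⌊ + 2 * + suc n - + 2 * + k / m ⌋ + ⌊ + 2 * + suc n - + 1 / m ⌋
            ≡ + ⌊ 3 ℕ.* k ⌋ₘ + + ⌊ 3 ℕ.* y ⌋ₘ + + ⌊ 3 ℕ.* suc n ⌋ₘ
              + + ⌊ 2 ℕ.* k ⌋ₘ + + ⌊ 2 ℕ.* y ⌋ₘ + + ⌊ suc (2 ℕ.* n) ⌋ₘ
  smaller = cong₂ _+_ (cong₂ _+_ (cong₂ _+_ (cong₂ _+_ (cong₂ _+_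
                (⌊⌋-embed _ (×-embed 3 k)) (⌊⌋-embed _ (scaled-difference 3 k y k+y≡)))
                (⌊⌋-embed _ (×-embed 3 (suc n)))) (⌊⌋-embed _ (×-embed 2 k)))
                (⌊⌋-embed _ (scaled-difference 2 k y k+y≡)))
                (⌊⌋-embed _ (double-minus-one n))
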